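{- There exist absolute constants $c>0$ and $M_1$ such that for every integer $M\ge M_1$ the following holds. Let $\mathcal{A}$ be any deterministic allocator for the Memory Reallocation problem with $M$ memory slots (where the total size of live objects may be as large as $M$) which satisfies the prefix property after every update. Then there is an update sequence on which some update incurs overhead factor at least $cM^{1/4}$.
   Context: Memory Reallocation problem: the memory consists of $M$ slots indexed $0,\dots,M-1$; there is a dynamically changing set $X$ of live objects with sizes $\mu(x)\in\mathbb{Z}^+$, with $\sum_{x\in X}\mu(x)\le M$ at all times. An allocation is a map $\phi\colon X\to\{0,\dots,M-1\}$ with $\phi(x)+\mu(x)\le M$ and the intervals $[\phi(x),\phi(x)+\mu(x))$ pairwise disjoint. Starting from $X=\varnothing$, updates (insert a new object of given size, or delete a live object) arrive online; after each update the allocator outputs an allocation of the new set $X'$, possibly moving existing objects. If the update inserts/deletes $x$ and the allocation changes from $\phi$ to $\phi'$, the overhead factor is $1+\frac{1}{\mu(x)}\sum_{y\in X\cap X',\ \phi(y)\ne\phi'(y)}\mu(y)$. The prefix property means that all live objects occupy a prefix $[0,\sum_{x\in X}\mu(x))$ of the memory with no gaps between them. -}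

module Defs where

open import Data.Nat using (ℕ; zero; suc; _+_; _*_; _≤_; _<_; _≟_)
open import Data.Nat.Properties using ()
open import Data.List using (List; []; _∷_; _++_; length; map)
open import Data.List.Membership.Propositional using (_∈_)
open import Data.Product using (_×_; _,_; ∃; Σ; proj₁)
open import Data.Sum using (_⊎_)
open import Relation.Binary.PropositionalEquality using (_≡_; _≢_)
open import Relation.Nullary using (yes; no)
import Data.List.Membership.DecPropositional as DecMem

_∈ℕ?_ = DecMem._∈?_ _≟_

-- An update: insert a new object of the given size, or delete the live
-- object with the given identifier.
data Update : Set where
  ins : ℕ → Update
  del : ℕ → Update

History : Set
History = List Update

-- A live object is a pair (identifier , size).  The object inserted by the
-- update at (0-based) position t of the history gets identifier t.
Obj : Set
Obj = ℕ × ℕ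

removeId : ℕ → List Obj → List Obj
removeId i [] = []
removeId i ((y , s) ∷ xs) with y ≟ i
... | yes _ = removeId i xs
... | no  _ = (y , s) ∷ removeId i xs

step : ℕ → List Obj → Update → List Obj
step t X (ins s) = (t , s) ∷ X
step t X (del i) = removeId i X

liveFrom : ℕ → List Obj → History → List Obj
liveFrom t X [] = X
liveFrom t X (u ∷ us) = liveFrom (suc t) (step t X u) us

live : History → List Obj
live h = liveFrom 0 [] h

ids : List Obj → List ℕ
ids = map proj₁

total : List Obj → ℕ
total [] = 0
total ((_ , s) ∷ xs) = s + total xs

-- size of the object with identifier i (0 if absent)
sizeOf : List Obj → ℕ → ℕ
sizeOf [] i = 0
sizeOf ((y , s) ∷ xs) i with y ≟ i
... | yes _ = s
... | no  _ = sizeOf xs i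

ValidUpdate : ℕ → History → Update → Set
ValidUpdate M h (ins s) = 1 ≤ s × total (live h) + s ≤ M
ValidUpdate M h (del i) = i ∈ ids (live h)

ValidSeq : ℕ → History → Set
ValidSeq M σ = ∀ h u rest → σ ≡ h ++ u ∷ rest → ValidUpdate M h u

-- an allocation φ (positions indexed by identifier) of the live set X
-- in memory of size M
ValidAlloc : ℕ → List Obj → (ℕ → ℕ) → Set
ValidAlloc M X φ =
  (∀ {y s} → (y , s) ∈ X → φ y + s ≤ M) ×
  (∀ {y s z t} → (y , s) ∈ X → (z , t) ∈ X → y ≢ z →
     (φ y + s ≤ φ z) ⊎ (φ z + t ≤ φ y))

Prefix : List Obj → (ℕ → ℕ) → Set
Prefix X φ =
  (∀ {y s} → (y , s) ∈ X → φ y + s ≤ total X) ×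
  (∀ p → p < total X → ∃ λ y → ∃ λ s → (y , s) ∈ X × φ y ≤ p × p < φ y + s)

-- a deterministic online allocator with M slots: the allocation output
-- after each update is a function of the update sequence so far
record Allocator (M : ℕ) : Set where
  field
    alloc : History → ℕ → ℕ
    valid : ∀ h → ValidSeq M h → ValidAlloc M (live h) (alloc h)

HasPrefixProperty : {M : ℕ} → Allocator M → Set
HasPrefixProperty {M} A =
  ∀ h → ValidSeq M h → Prefix (live h) (Allocator.alloc A h)

updSize : History → Update → ℕ
updSize h (ins s) = s
updSize h (del i) = sizeOf (live h) i

moved : List Obj → List ℕ → (ℕ → ℕ) → (ℕ → ℕ) → ℕ
moved [] X' φ φ' = 0
moved ((y , s) ∷ xs) X' φ φ' with y ∈ℕ? X' | φ y ≟ φ' y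
... | yes _ | no _ = s + moved xs X' φ φ'
... | _     | _    = moved xs X' φ φ'

movedBy : {M : ℕ} → Allocator M → History → Update → ℕ
movedBy A h u =
  moved (live h) (ids (live (h ++ u ∷ []))) (Allocator.alloc A h)
        (Allocator.alloc A (h ++ u ∷ []))

{-# OPTIONS --safe #-}
module Submission where

-- Let B be the largest odd number with B² ≤ M.  Insert k = (B² − B)/2
-- objects of size 2, then one object of size B.  Under the prefix property
-- every object starts where its left neighbour ends, and objects of size 2
-- preserve parity, so before the last insertion all small objects start at
-- even positions.  If the big object is placed at 0 it ends at the odd
-- position B, so every small object is pushed to an odd position: an
-- insertion of size B moves B² − B.  Otherwise keep deleting the object at
-- position 0, which is always small: the occupied prefix shrinks while the
-- big object has to stay inside it, so eventually a deletion of size 2 moves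
-- it, i.e. moves B.  Either way the overhead factor is at least B/2, of
-- order √M.

open import Defs
open import Data.Nat
  using (ℕ; zero; suc; _+_; _*_; _^_; _%_; _≤_; _<_; _≟_; _<?_; z≤n; s≤s; NonZero)
open import Data.Nat.Properties
open import Data.Nat.DivMod using ([m+n]%n≡m%n; [m+kn]%n≡m%n; m*n%n≡0)
open import Data.Nat.Induction using (<-wellFounded)
open import Data.Nat.Solver using (module +-*-Solver)
open import Induction.WellFounded using (Acc; acc)
open import Data.List using (List; []; _∷_; _++_; _∷ʳ_; length)
open import Data.List.Properties using (∷-injective; length-++)
open import Data.List.Relation.Unary.Any using (here; there; tail)
open import Data.List.Membership.Propositional using (_∈_)
open import Data.List.Membership.Propositional.Properties using (∈-map⁺)
open import Data.Product using (_×_; _,_; proj₁; proj₂; ∃; ∃₂)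
open import Data.Sum using (_⊎_; inj₁; inj₂; [_,_]′)
open import Data.Empty using (⊥-elim)
open import Function using (_∘_)
open import Relation.Nullary using (¬_; Dec; yes; no)
open import Relation.Binary.PropositionalEquality
open +-*-Solver using (solve; _:=_; _:+_; _:*_; _:^_; con)

private
  variable
    A : Set
    M n s : ℕ
    X : List Obj
    φ φ′ : ℕ → ℕ

∷ʳ-split : ∀ (xs ys : List A) {x y zs} → xs ∷ʳ x ≡ ys ++ y ∷ zs →
           (xs ≡ ys × x ≡ y) ⊎ ∃ λ zs′ → xs ≡ ys ++ y ∷ zs′
∷ʳ-split []       []           refl = inj₁ (refl , refl)
∷ʳ-split []       (_ ∷ [])     ()
∷ʳ-split []       (_ ∷ _ ∷ _)  ()
∷ʳ-split (_ ∷ xs) []           refl = inj₂ (xs , refl)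
∷ʳ-split (_ ∷ xs) (_ ∷ ys) eq with refl , eq′ ← ∷-injective eq with ∷ʳ-split xs ys eq′
... | inj₁ (refl , x≡y)  = inj₁ (refl , x≡y)
... | inj₂ (zs′ , refl) = inj₂ (zs′ , refl)

ValidSeq-[] : ValidSeq M []
ValidSeq-[] []      _ _ ()
ValidSeq-[] (_ ∷ _) _ _ ()

ValidSeq-∷ʳ : ∀ {h u} → ValidSeq M h → ValidUpdate M h u → ValidSeq M (h ∷ʳ u)
ValidSeq-∷ʳ {h = h} valid-h valid-u h′ u′ rest eq with ∷ʳ-split h h′ eq
... | inj₁ (refl , refl) = valid-u
... | inj₂ (zs , h≡) = valid-h h′ u′ zs h≡

liveFrom-∷ʳ : ∀ t X h u → liveFrom t X (h ∷ʳ u) ≡ step (t + length h) (liveFrom t X h) u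
liveFrom-∷ʳ t X []      u = cong (λ t′ → step t′ X u) (sym (+-identityʳ t))
liveFrom-∷ʳ t X (v ∷ h) u =
  trans (liveFrom-∷ʳ (suc t) (step t X v) h u)
        (cong (λ t′ → step t′ (liveFrom (suc t) (step t X v) h) u) (sym (+-suc t (length h))))

live-∷ʳ : ∀ h u → live (h ∷ʳ u) ≡ step (length h) (live h) u
live-∷ʳ = liveFrom-∷ʳ 0 []

inserts : ℕ → ℕ → History
inserts zero    s = []
inserts (suc n) s = inserts n s ∷ʳ ins s

length-inserts : ∀ n s → length (inserts n s) ≡ n
length-inserts zero    s = refl
length-inserts (suc n) s =
  trans (length-++ (inserts n s)) (trans (cong (_+ 1) (length-inserts n s)) (+-comm n 1))

live-inserts : ∀ n s → live (inserts (suc n) s) ≡ (n , s) ∷ live (inserts n s)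
live-inserts n s =
  trans (live-∷ʳ (inserts n s) (ins s))
        (cong (λ t → (t , s) ∷ live (inserts n s)) (length-inserts n s))

total-inserts : ∀ n s → total (live (inserts n s)) ≡ n * s
total-inserts zero    s = refl
total-inserts (suc n) s rewrite live-inserts n s = cong (s +_) (total-inserts n s)

∈-inserts : ∀ n {y s′} → (y , s′) ∈ live (inserts n s) → s′ ≡ s × y < n
∈-inserts {s = s} (suc n) y∈ with subst (_ ∈_) (live-inserts n s) y∈
... | here refl = refl , n<1+n n
... | there y∈′ = proj₁ (∈-inserts n y∈′) , m<n⇒m<1+n (proj₂ (∈-inserts n y∈′))

ValidSeq-inserts : ∀ n → 1 ≤ s → n * s ≤ M → ValidSeq M (inserts n s)
ValidSeq-inserts zero    _   _ = ValidSeq-[]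
ValidSeq-inserts {s = s} {M} (suc n) 1≤s fits =
  ValidSeq-∷ʳ (ValidSeq-inserts n 1≤s (m+n≤o⇒n≤o s fits)) (1≤s , room)
  where
    room : total (live (inserts n s)) + s ≤ M
    room rewrite total-inserts n s | +-comm (n * s) s = fits

∈-removeId⁻ : ∀ i X {x} → x ∈ removeId i X → x ∈ X
∈-removeId⁻ i ((y , s) ∷ X) x∈ with y ≟ i
... | yes _ = there (∈-removeId⁻ i X x∈)
∈-removeId⁻ i ((y , s) ∷ X) (here refl) | no _ = here refl
∈-removeId⁻ i ((y , s) ∷ X) (there x∈) | no _ = there (∈-removeId⁻ i X x∈)

∈-removeId⁺ : ∀ i X {y s} → (y , s) ∈ X → y ≢ i → (y , s) ∈ removeId i X
∈-removeId⁺ i ((z , t) ∷ X) y∈ y≢i with z ≟ i | y∈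
... | yes refl | here refl  = ⊥-elim (y≢i refl)
... | yes _    | there y∈′ = ∈-removeId⁺ i X y∈′ y≢i
... | no _     | here refl  = here refl
... | no _     | there y∈′ = there (∈-removeId⁺ i X y∈′ y≢i)

total-removeId-≤ : ∀ i X → total (removeId i X) ≤ total X
total-removeId-≤ i []            = z≤n
total-removeId-≤ i ((y , s) ∷ X) with y ≟ i
... | yes _ = ≤-trans (total-removeId-≤ i X) (m≤n+m (total X) s)
... | no _  = +-monoʳ-≤ s (total-removeId-≤ i X)

total-removeId : ∀ i X {s} → (i , s) ∈ X → total (removeId i X) + s ≤ total X
total-removeId i ((y , t) ∷ X) i∈ with y ≟ i | i∈
... | yes _    | here refl  =
  ≤-trans (≤-reflexive (+-comm _ t)) (+-monoʳ-≤ t (total-removeId-≤ i X))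
... | yes _    | there i∈′ = ≤-trans (total-removeId i X i∈′) (m≤n+m (total X) t)
... | no  y≢i  | here refl  = ⊥-elim (y≢i refl)
... | no  _    | there i∈′ =
  ≤-trans (≤-reflexive (+-assoc t _ _)) (+-monoʳ-≤ t (total-removeId i X i∈′))

sizeOf-∈ : ∀ X {y} → y ∈ ids X → (y , sizeOf X y) ∈ X
sizeOf-∈ ((z , t) ∷ X) {y} y∈ with z ≟ y
... | yes refl = here refl
... | no z≢y   = there (sizeOf-∈ X (tail (z≢y ∘ sym) y∈))

size-≤-moved : ∀ X X′ {y s} → (y , s) ∈ X → y ∈ X′ → φ y ≢ φ′ y → s ≤ moved X X′ φ φ′
size-≤-moved {φ} {φ′} ((z , t) ∷ X) X′ y∈ y∈X′ shifted with z ∈ℕ? X′ | φ z ≟ φ′ z | y∈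
... | yes _  | no _     | here refl  = m≤m+n t _
... | yes _  | no _     | there y∈′ = ≤-trans (size-≤-moved X X′ y∈′ y∈X′ shifted) (m≤n+m _ t)
... | yes _  | yes same | here refl  = ⊥-elim (shifted same)
... | yes _  | yes _    | there y∈′ = size-≤-moved X X′ y∈′ y∈X′ shifted
... | no ∉X′ | _        | here refl  = ⊥-elim (∉X′ y∈X′)
... | no _   | _        | there y∈′ = size-≤-moved X X′ y∈′ y∈X′ shifted

total-≤-moved : ∀ X X′ → (∀ {y s} → (y , s) ∈ X → y ∈ X′ × φ y ≢ φ′ y) →
                total X ≤ moved X X′ φ φ′
total-≤-moved                 []            X′ all-moved = z≤n
total-≤-moved {φ = φ} {φ′} ((z , t) ∷ X) X′ all-moved
  with z ∈ℕ? X′ | φ z ≟ φ′ z | all-moved (here refl)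
... | yes _  | no _     | _ = +-monoʳ-≤ t (total-≤-moved X X′ (all-moved ∘ there))
... | yes _  | yes same | (_ , shifted) = ⊥-elim (shifted same)
... | no ∉X′ | _        | (z∈X′ , _) = ⊥-elim (∉X′ z∈X′)

Disjoint : List Obj → (ℕ → ℕ) → Set
Disjoint X φ =
  ∀ {y s z t} → (y , s) ∈ X → (z , t) ∈ X → y ≢ z → (φ y + s ≤ φ z) ⊎ (φ z + t ≤ φ y)

distinct-starts : Disjoint X φ → ∀ {y s z t} → (y , s) ∈ X → (z , t) ∈ X → y ≢ z →
                  0 < s → 0 < t → φ y ≢ φ z
distinct-starts {φ = φ} disjoint {y} {suc s} {z} {suc t} y∈ z∈ y≢z (s≤s _) (s≤s _) φy≡φz
  with disjoint y∈ z∈ y≢z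
... | inj₁ φy+s≤φz = m+1+n≰m (φ y) (subst (φ y + suc s ≤_) (sym φy≡φz) φy+s≤φz)
... | inj₂ φz+t≤φy = m+1+n≰m (φ z) (subst (φ z + suc t ≤_) φy≡φz φz+t≤φy)

left-neighbour : Disjoint X φ → Prefix X φ → ∀ {y s p} → (y , s) ∈ X → φ y ≡ suc p →
                 ∃₂ λ z t → (z , t) ∈ X × φ z ≤ p × φ z + t ≡ suc p
left-neighbour {X} {φ} disjoint (fits , covers) {y} {s} {p} y∈ φy≡1+p =
  ends-at-y (covers p p<total)
  where
    p<total : p < total X
    p<total = ≤-trans (≤-trans (≤-reflexive (sym φy≡1+p)) (m≤m+n (φ y) s)) (fits y∈)

    ends-at-y : (∃₂ λ z t → (z , t) ∈ X × φ z ≤ p × p < φ z + t) →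
                ∃₂ λ z t → (z , t) ∈ X × φ z ≤ p × φ z + t ≡ suc p
    ends-at-y (z , t , z∈ , φz≤p , p<φz+t) = z , t , z∈ , φz≤p , ≤-antisym ends-by-y p<φz+t
      where
        y-after-z : ¬ φ y ≤ φ z
        y-after-z = <⇒≱ (subst (φ z <_) (sym φy≡1+p) (s≤s φz≤p))

        z≢y : z ≢ y
        z≢y refl = y-after-z ≤-refl

        ends-by-y : φ z + t ≤ suc p
        ends-by-y = [ subst (φ z + t ≤_) φy≡1+p
                    , (λ φy+s≤φz → ⊥-elim (y-after-z (m+n≤o⇒m≤o (φ y) φy+s≤φz))) ]′
                    (disjoint z∈ y∈ z≢y)

module _ (disjoint : Disjoint X φ) (prefix : Prefix X φ) {d v : ℕ} .{{_ : NonZero d}}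
         (ends : ∀ {z t} → (z , t) ∈ X → t ≡ d ⊎ (φ z + t) % d ≡ v)
         (origin : ∀ {y} → (y , d) ∈ X → φ y ≡ 0 → v ≡ 0) where

  private
    residue : Acc _<_ n → ∀ {y} → (y , d) ∈ X → φ y ≡ n → φ y % d ≡ v
    residue {zero} _ y∈ φy≡0 =
      trans (cong (_% d) φy≡0) (trans (m*n%n≡0 0 d) (sym (origin y∈ φy≡0)))
    residue {suc p} (acc smaller) y∈ φy≡1+p
      with z , t , z∈ , φz≤p , φz+t≡1+p ← left-neighbour disjoint prefix y∈ φy≡1+p
      = trans (cong (_% d) (trans φy≡1+p (sym φz+t≡1+p))) (end-residue (ends z∈))
      where
        end-residue : t ≡ d ⊎ (φ z + t) % d ≡ v → (φ z + t) % d ≡ v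
        end-residue (inj₂ end≡v) = end≡v
        end-residue (inj₁ refl)  =
          trans ([m+n]%n≡m%n (φ z) d) (residue (smaller (s≤s φz≤p)) z∈ refl)

  start-residue : ∀ {y} → (y , d) ∈ X → φ y % d ≡ v
  start-residue y∈ = residue (<-wellFounded _) y∈ refl

odd : ℕ → ℕ
odd c = 1 + c * 2

odd-sqrt : ∀ M → 1 ≤ M → ∃ λ c → odd c ^ 2 ≤ M × M < odd (suc c) ^ 2
odd-sqrt (suc zero)        _ = 0 , ≤-refl , s≤s (s≤s z≤n)
odd-sqrt (suc M@(suc _)) _ with odd-sqrt M (s≤s z≤n)
... | c , lower , upper with suc M <? odd (suc c) ^ 2
...   | yes upper′ = c , m≤n⇒m≤1+n lower , upper′
...   | no  ¬upper′ = suc c , ≮⇒≥ ¬upper′ , ≤-<-trans upper (^-monoˡ-< 2 odd-<)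
  where
    odd-< : odd (suc c) < odd (suc (suc c))
    odd-< = <-trans (n<1+n _) (n<1+n _)

square≤fourth : ∀ n → n ^ 2 ≤ n ^ 4
square≤fourth zero    = z≤n
square≤fourth (suc n) =
  ≤-trans (m≤m*n (suc n ^ 2) (suc n ^ 2) {{m^n≢0 (suc n) 2}})
          (≤-reflexive (sym (^-distribˡ-+-* (suc n) 2 2)))

deletion-overhead : ∀ {M b t} → M < (2 + b) ^ 2 → 2 + b ≤ t → M * 2 ^ 4 ≤ 2 ^ 4 * t ^ 4
deletion-overhead {M} {b} {t} M<[2+b]² 2+b≤t =
  ≤-trans (*-monoˡ-≤ (2 ^ 4) M≤t⁴) (≤-reflexive (*-comm (t ^ 4) (2 ^ 4)))
  where
    M≤t⁴ : M ≤ t ^ 4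
    M≤t⁴ = ≤-trans (<⇒≤ M<[2+b]²) (≤-trans (^-monoˡ-≤ 2 2+b≤t) (square≤fourth t))

insertion-overhead : ∀ {M b t} → M < (2 + b) ^ 2 → 1 ≤ b → b ^ 2 ≤ t →
                     M * b ^ 4 ≤ 2 ^ 4 * t ^ 4
insertion-overhead {M} {b@(suc b′)} {t} M<[2+b]² _ b²≤t = begin
  M * b ^ 4                ≤⟨ *-monoˡ-≤ (b ^ 4) M≤[2b]⁴ ⟩
  (2 * b) ^ 4 * b ^ 4      ≡⟨ regroup b ⟩
  2 ^ 4 * (b ^ 2) ^ 4      ≤⟨ *-monoʳ-≤ (2 ^ 4) (^-monoˡ-≤ 4 b²≤t) ⟩
  2 ^ 4 * t ^ 4            ∎
  where
    open ≤-Reasoning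
    regroup : ∀ b → (2 * b) ^ 4 * b ^ 4 ≡ 2 ^ 4 * (b ^ 2) ^ 4
    regroup = solve 1 (λ b → ((con 2 :* b) :^ 4) :* (b :^ 4) := con 16 :* ((b :^ 2) :^ 4)) refl
    expand : ∀ b → 3 + b + (1 + 7 * b + 4 * b ^ 2) ≡ (2 * (1 + b)) ^ 2
    expand = solve 1 (λ b → con 3 :+ b :+ (con 1 :+ con 7 :* b :+ con 4 :* b :^ 2)
                           := (con 2 :* (con 1 :+ b)) :^ 2) refl
    2+b≤[2b]² : 2 + b ≤ (2 * b) ^ 2
    2+b≤[2b]² = ≤-trans (m≤m+n (2 + b) _) (≤-reflexive (expand b′))
    M≤[2b]⁴ : M ≤ (2 * b) ^ 4
    M≤[2b]⁴ = ≤-trans (<⇒≤ M<[2+b]²)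
                      (≤-trans (^-monoˡ-≤ 2 2+b≤[2b]²) (≤-reflexive (^-*-assoc (2 * b) 2 2)))

CostlyUpdate : Allocator M → Set
CostlyUpdate {M} A = ∃ λ h → ∃ λ u → ∃ λ rest → ValidSeq M (h ++ u ∷ rest) ×
  M * updSize h u ^ 4 ≤ 2 ^ 4 * (updSize h u + movedBy A h u) ^ 4

module Adversary (A : Allocator M) (prefix-property : HasPrefixProperty A) (c : ℕ)
                 (B²≤M : odd c ^ 2 ≤ M) (M<[2+B]² : M < (2 + odd c) ^ 2) where

  open Allocator A

  B k : ℕ
  B = odd c
  k = c * B

  k*2+B≡B² : k * 2 + B ≡ B ^ 2
  k*2+B≡B² = lemma c
    where
      lemma : ∀ c → c * (1 + c * 2) * 2 + (1 + c * 2) ≡ (1 + c * 2) ^ 2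
      lemma = solve 1 (λ c → c :* (con 1 :+ c :* con 2) :* con 2 :+ (con 1 :+ c :* con 2)
                             := (con 1 :+ c :* con 2) :^ 2) refl

  B-odd : B % 2 ≡ 1
  B-odd = [m+kn]%n≡m%n 1 c 2

  B≢2 : B ≢ 2
  B≢2 B≡2 = 1+n≢0 (trans (sym B-odd) (cong (_% 2) B≡2))

  disjoint : ∀ {g} → ValidSeq M g → Disjoint (live g) (alloc g)
  disjoint {g} valid-g = proj₂ (valid g valid-g)

  -- g₁ is the (k+1)-st insertion, so k is also the identifier of the big object.
  g₀ g₁ : History
  g₀ = inserts k 2
  g₁ = g₀ ∷ʳ ins B

  valid₀ : ValidSeq M g₀
  valid₀ = ValidSeq-inserts k (s≤s z≤n)
                             (m+n≤o⇒m≤o (k * 2) (≤-trans (≤-reflexive k*2+B≡B²) B²≤M))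

  valid₁ : ValidSeq M g₁
  valid₁ = ValidSeq-∷ʳ valid₀ (s≤s z≤n , room)
    where
      room : total (live g₀) + B ≤ M
      room rewrite total-inserts k 2 | k*2+B≡B² = B²≤M

  live₁ : live g₁ ≡ (k , B) ∷ live g₀
  live₁ = trans (live-∷ʳ g₀ (ins B)) (cong (λ t → (t , B) ∷ live g₀) (length-inserts k 2))

  from₁ : ∀ {x} → x ∈ (k , B) ∷ live g₀ → x ∈ live g₁
  from₁ {x} = subst (x ∈_) (sym live₁)

  ∈-live₁ : ∀ {x} → x ∈ live g₁ → x ≡ (k , B) ⊎ x ∈ live g₀
  ∈-live₁ {x} x∈ with subst (x ∈_) live₁ x∈
  ... | here x≡  = inj₁ x≡
  ... | there x∈₀ = inj₂ x∈₀

  even-before : ∀ {y s} → (y , s) ∈ live g₀ → alloc g₀ y % 2 ≡ 0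
  even-before y∈ with refl , _ ← ∈-inserts k y∈ =
    start-residue (disjoint valid₀) (prefix-property g₀ valid₀)
                  (inj₁ ∘ proj₁ ∘ ∈-inserts k) (λ _ _ → refl) y∈

  odd-after : alloc g₁ k ≡ 0 → ∀ {y s} → (y , s) ∈ live g₀ → alloc g₁ y % 2 ≡ 1
  odd-after k-first y∈ with refl , _ ← ∈-inserts k y∈ =
    start-residue (disjoint valid₁) (prefix-property g₁ valid₁) ends origin
                  (from₁ (there y∈))
    where
      ends : ∀ {z t} → (z , t) ∈ live g₁ → t ≡ 2 ⊎ (alloc g₁ z + t) % 2 ≡ 1
      ends z∈ with ∈-live₁ z∈
      ... | inj₁ refl = inj₂ (trans (cong (λ p → (p + B) % 2) k-first) B-odd)
      ... | inj₂ z∈₀  = inj₁ (proj₁ (∈-inserts k z∈₀))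

      origin : ∀ {z} → (z , 2) ∈ live g₁ → alloc g₁ z ≡ 0 → 1 ≡ 0
      origin z∈ z-first with ∈-live₁ z∈
      ... | inj₁ z≡k  = ⊥-elim (B≢2 (sym (cong proj₂ z≡k)))
      ... | inj₂ z∈₀  = ⊥-elim (distinct-starts (disjoint valid₁) z∈ (from₁ (here refl))
                          (<⇒≢ (proj₂ (∈-inserts k z∈₀))) (s≤s z≤n) (s≤s z≤n)
                          (trans z-first (sym k-first)))

  insertion-costly : alloc g₁ k ≡ 0 → CostlyUpdate A
  insertion-costly k-first =
    g₀ , ins B , [] , valid₁ ,
    insertion-overhead {b = B} M<[2+B]² (s≤s z≤n) B²≤B+moved
    where
      all-small-moved : total (live g₀) ≤ movedBy A g₀ (ins B)
      all-small-moved = total-≤-moved (live g₀) (ids (live g₁)) λ y∈ →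
        ∈-map⁺ proj₁ (from₁ (there y∈)) ,
        λ same → 1+n≢0 (trans (sym (odd-after k-first y∈))
                              (trans (cong (_% 2) (sym same)) (even-before y∈)))

      B²≤B+moved : B ^ 2 ≤ B + movedBy A g₀ (ins B)
      B²≤B+moved = begin
        B ^ 2                     ≡⟨ sym k*2+B≡B² ⟩
        k * 2 + B                 ≡⟨ +-comm (k * 2) B ⟩
        B + k * 2                 ≡⟨ cong (B +_) (sym (total-inserts k 2)) ⟩
        B + total (live g₀)       ≤⟨ +-monoʳ-≤ B all-small-moved ⟩
        B + movedBy A g₀ (ins B)  ∎
        where open ≤-Reasoning

  record Stage (g : History) : Set where
    field
      valid-g       : ValidSeq M g
      big∈          : (k , B) ∈ live g
      others-small  : ∀ {z s} → (z , s) ∈ live g → z ≢ k → s ≡ 2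
      big-not-first : alloc g k ≢ 0

  Progress : History → Set
  Progress g = CostlyUpdate A ⊎ ∃ λ g′ → Stage g′ × total (live g′) < total (live g)

  first-small : ∀ {g} → Stage g → ∃ λ y → (y , 2) ∈ live g × y ≢ k
  first-small {g} stage = first (proj₂ (prefix-property g valid-g) 0 0<total)
    where
      open Stage stage
      0<total : 0 < total (live g)
      0<total = ≤-trans (n≢0⇒n>0 big-not-first)
                        (m+n≤o⇒m≤o (alloc g k) (proj₁ (prefix-property g valid-g) big∈))

      first : (∃₂ λ y s → (y , s) ∈ live g × alloc g y ≤ 0 × 0 < alloc g y + s) →
              ∃ λ y → (y , 2) ∈ live g × y ≢ k
      first (y , s , y∈ , y-first , _) =
        y , subst (λ s → (y , s) ∈ live g) (others-small y∈ y≢k) y∈ , y≢k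
        where
          y≢k : y ≢ k
          y≢k refl = big-not-first (n≤0⇒n≡0 y-first)

  delete-small : ∀ {g y} → Stage g → (y , 2) ∈ live g → y ≢ k → Progress g
  delete-small {g} {y} stage y∈ y≢k = outcome (alloc g′ k ≟ alloc g k)
    where
      open Stage stage
      g′ = g ∷ʳ del y

      valid′ : ValidSeq M g′
      valid′ = ValidSeq-∷ʳ valid-g (∈-map⁺ proj₁ y∈)

      live′ : live g′ ≡ removeId y (live g)
      live′ = live-∷ʳ g (del y)

      big∈′ : (k , B) ∈ live g′
      big∈′ = subst ((k , B) ∈_) (sym live′) (∈-removeId⁺ y (live g) big∈ (y≢k ∘ sym))

      size≡2 : updSize g (del y) ≡ 2
      size≡2 = others-small (sizeOf-∈ (live g) (∈-map⁺ proj₁ y∈)) y≢k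

      shrinks : total (live g′) < total (live g)
      shrinks = <-≤-trans (m<m+n _ (s≤s z≤n))
                          (subst (λ X → total X + 2 ≤ total (live g)) (sym live′)
                                 (total-removeId y (live g) y∈))

      outcome : Dec (alloc g′ k ≡ alloc g k) → Progress g
      outcome (no big-moved) = inj₁ (g , del y , [] , valid′ ,
        subst (λ s → M * s ^ 4 ≤ 2 ^ 4 * (s + movedBy A g (del y)) ^ 4) (sym size≡2)
              (deletion-overhead M<[2+B]² (+-monoʳ-≤ 2 B≤moved)))
        where
          B≤moved : B ≤ movedBy A g (del y)
          B≤moved = size-≤-moved (live g) (ids (live g′)) big∈ (∈-map⁺ proj₁ big∈′)
                                 (big-moved ∘ sym)
      outcome (yes big-stays) = inj₂ (g′ , stage′ , shrinks)
        where
          stage′ : Stage g′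
          stage′ = record
            { valid-g       = valid′
            ; big∈          = big∈′
            ; others-small  = others-small ∘ ∈-removeId⁻ y (live g) ∘ subst (_ ∈_) live′
            ; big-not-first = big-not-first ∘ trans (sym big-stays)
            }

  deletion-phase : ∀ {g} → Acc _<_ (total (live g)) → Stage g → CostlyUpdate A
  deletion-phase (acc smaller) stage with y , y∈ , y≢k ← first-small stage
    with delete-small stage y∈ y≢k
  ... | inj₁ costly                  = costly
  ... | inj₂ (g′ , stage′ , shrinks) = deletion-phase (smaller shrinks) stage′

  stage₁ : alloc g₁ k ≢ 0 → Stage g₁
  stage₁ k-not-first = record
    { valid-g       = valid₁
    ; big∈          = from₁ (here refl)
    ; others-small  = others-small
    ; big-not-first = k-not-first
    }
    where
      others-small : ∀ {z s} → (z , s) ∈ live g₁ → z ≢ k → s ≡ 2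
      others-small z∈ z≢k with ∈-live₁ z∈
      ... | inj₁ refl = ⊥-elim (z≢k refl)
      ... | inj₂ z∈₀  = proj₁ (∈-inserts k z∈₀)

  costly : CostlyUpdate A
  costly with alloc g₁ k ≟ 0
  ... | yes k-first     = insertion-costly k-first
  ... | no  k-not-first = deletion-phase (<-wellFounded _) (stage₁ k-not-first)

proposition1p6 :
    ∃ λ q → NonZero q × ∃ λ M₁ → ∀ M → M₁ ≤ M →
      (A : Allocator M) → HasPrefixProperty A →
      ∃ λ h → ∃ λ u → ∃ λ rest → ValidSeq M (h ++ u ∷ rest) ×
        M * updSize h u ^ 4 ≤ q ^ 4 * (updSize h u + movedBy A h u) ^ 4
proposition1p6 = 2 , _ , 1 , λ M 1≤M A prefix-property →
  let c , B²≤M , M<[2+B]² = odd-sqrt M 1≤M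
  in  Adversary.costly A prefix-property c B²≤M M<[2+B]²
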